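{- Let $w\in\Sigma^n$. If $\mathtt{BR}(w)$ contains no rich element, then $|\mathrm{Alph}(w)|<n-1$.
   Context: $\mathrm{Alph}(w)$ is the set of letters occurring in $w$. $\mathtt{BR}(w)=\{B_t\cdots B_1 : w=B_1\cdots B_t,\ t\ge1,\ B_i\in\Sigma^+\}$. A word $w$ is rich if it has exactly $|w|$ distinct non-empty palindromic factors. -}

module Defs where

open import Data.List using (List; []; _∷_; _++_; reverse; length; concat; deduplicate)
open import Data.List.Membership.Propositional using (_∈_)
open import Data.List.Relation.Unary.All using (All)
open import Data.List.Relation.Unary.Unique.Propositional using (Unique)
open import Data.Product using (Σ; ∃; ∃-syntax; _×_)
open import Data.Nat using (ℕ)
open import Relation.Binary.PropositionalEquality using (_≡_; _≢_)
open import Relation.Binary.Definitions using (DecidableEquality)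
open import Function.Bundles using (_⇔_)

module _ {A : Set} where

  Factor : List A → List A → Set
  Factor u w = ∃[ x ] ∃[ y ] (x ++ u ++ y ≡ w)

  Palindrome : List A → Set
  Palindrome u = reverse u ≡ u

  NEPalFactor : List A → List A → Set
  NEPalFactor w u = (u ≢ []) × Palindrome u × Factor u w

  Rich : List A → Set
  Rich w = ∃[ L ] (Unique L × (∀ u → (u ∈ L) ⇔ NEPalFactor w u) × (length L ≡ length w))

  InBR : List A → List A → Set
  InBR u w = ∃[ Bs ] ((Bs ≢ []) × All (λ B → B ≢ []) Bs × (concat Bs ≡ w) × (u ≡ concat (reverse Bs)))

  alphSize : DecidableEquality A → List A → ℕ
  alphSize _≟_ w = length (deduplicate _≟_ w)

-- If |Alph(w)| ≥ n − 1, then either all letters of w are distinct, or exactly one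
-- letter a occurs twice, w = x a y a z, with all other letters distinct. In the
-- first case w itself lies in BR(w), and its non-empty palindromic factors are
-- exactly its n letters. In the second case, cutting w into the blocks x, ay, a, z
-- and reversing their order gives z a a y x ∈ BR(w); there the only repeated
-- letters are adjacent, so its non-empty palindromic factors are its n − 1
-- distinct letters together with aa. Either way BR(w) has a rich element.
module Submission where

open import Defs
open import Data.List using (List; []; _∷_; _++_; [_]; length; reverse; concat; map; deduplicate)
open import Data.List.Properties
  using (∷-injective; ∷-injectiveˡ; ++-assoc; ++-identityʳ; ++-conicalʳ; unfold-reverse; concat-++;
         length-map; length-++-sucʳ; filter-all; filter-notAll; length-deduplicate)
open import Data.List.Membership.Propositional using (_∈_; _∉_)
open import Data.List.Membership.Propositional.Properties
  using (∈-++⁺ˡ; ∈-++⁺ʳ; ∈-++⁻; ∈-∃++; ∈-map⁺; ∈-map⁻; ∈-deduplicate⁺; ∈-deduplicate⁻)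
import Data.List.Membership.DecPropositional as DecMembership
open import Data.List.Relation.Unary.All as All using (All; []; _∷_)
open import Data.List.Relation.Unary.All.Properties using (¬Any⇒All¬) renaming (map⁺ to All-map⁺)
open import Data.List.Relation.Unary.Any as Any using (here; there)
open import Data.List.Relation.Unary.Unique.Propositional using (Unique; []; _∷_)
open import Data.List.Relation.Unary.Unique.Propositional.Properties as Unique using (Unique[x∷xs]⇒x∉xs)
open import Data.List.Relation.Binary.Subset.Propositional using (_⊆_)
open import Data.List.Relation.Binary.Subset.Propositional.Properties using (xs⊆x∷xs; ++⁺ʳ)
import Data.List.Relation.Binary.Permutation.Setoid as Permutation
import Data.List.Relation.Binary.Permutation.Setoid.Properties as PermutationProperties
open import Data.Product using (∃-syntax; _×_; _,_; proj₂)
open import Data.Sum using (_⊎_; inj₁; inj₂)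
open import Data.Empty using (⊥-elim)
open import Data.Nat using (ℕ; suc; _<_; _≤_; _+_; s≤s⁻¹; _<?_)
open import Data.Nat.Properties using (≤-trans; ≤-reflexive; +-comm; n≮n; ≮⇒≥)
open import Relation.Binary.PropositionalEquality
  using (_≡_; _≢_; refl; sym; trans; cong; subst; subst₂; module ≡-Reasoning)
open import Relation.Binary.PropositionalEquality.Properties using (setoid)
open import Relation.Binary.Definitions using (DecidableEquality)
open import Relation.Nullary using (¬_; yes; no; ¬?; contradiction)
open import Function using (_∘_; case_of_)
open import Function.Bundles using (mk⇔)

module _ {A : Set} where

  Unique-∷ : ∀ {b : A} {w} → b ∉ w → Unique w → Unique (b ∷ w)
  Unique-∷ {w = w} b∉w uw = ¬Any⇒All¬ w b∉w ∷ uw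

  repeated⇒¬Unique : ∀ (x : List A) {c l} → c ∈ l → ¬ Unique (x ++ c ∷ l)
  repeated⇒¬Unique []      c∈l u       = Unique[x∷xs]⇒x∉xs u c∈l
  repeated⇒¬Unique (_ ∷ x) c∈l (_ ∷ u) = repeated⇒¬Unique x c∈l u

  palindrome-∷ : ∀ (c : A) t → Palindrome (c ∷ t) → t ≡ [] ⊎ ∃[ m ] t ≡ m ++ [ c ]
  palindrome-∷ c t pal with reverse t | trans (sym (unfold-reverse c t)) pal
  ... | []    | eq = inj₁ (sym (proj₂ (∷-injective eq)))
  ... | _ ∷ m | eq = inj₂ (m , sym (proj₂ (∷-injective eq)))

  ∈⇒letter-NEPalFactor : ∀ {c : A} {u} → c ∈ u → NEPalFactor u [ c ]
  ∈⇒letter-NEPalFactor c∈u with ∈-∃++ c∈u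
  ... | x , y , eq = (λ ()) , refl , x , y , sym eq

  NEPalFactor-cases : ∀ {u v : List A} → NEPalFactor u v →
    (∃[ c ] v ≡ [ c ] × c ∈ u) ⊎
    (∃[ c ] ∃[ m ] v ≡ c ∷ m ++ [ c ] × ∃[ x ] ∃[ y ] x ++ c ∷ m ++ c ∷ y ≡ u)
  NEPalFactor-cases {v = []}    (v≢[] , _) = ⊥-elim (v≢[] refl)
  NEPalFactor-cases {v = c ∷ t} (_ , pal , x , y , refl) with palindrome-∷ c t pal
  ... | inj₁ refl       = inj₁ (c , refl , ∈-++⁺ʳ x (here refl))
  ... | inj₂ (m , refl) =
    inj₂ (c , m , refl , x , y , cong (λ k → x ++ c ∷ k) (sym (++-assoc m [ c ] y)))

  Unique⇒Rich : ∀ {u : List A} → Unique u → Rich u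
  Unique⇒Rich {u} uu = map [_] u , Unique.map⁺ ∷-injectiveˡ uu , (λ v → mk⇔ to from) , length-map [_] u
    where
    to : ∀ {v} → v ∈ map [_] u → NEPalFactor u v
    to v∈ with ∈-map⁻ [_] v∈
    ... | _ , c∈u , refl = ∈⇒letter-NEPalFactor c∈u
    from : ∀ {v} → NEPalFactor u v → v ∈ map [_] u
    from pf with NEPalFactor-cases pf
    ... | inj₁ (_ , refl , c∈u) = ∈-map⁺ [_] c∈u
    ... | inj₂ (_ , m , _ , x , _ , refl) = ⊥-elim (repeated⇒¬Unique x (∈-++⁺ʳ m (here refl)) uu)

  ∈-doubled⁺ : ∀ {c a : A} z r → c ∈ a ∷ z ++ r → c ∈ z ++ a ∷ a ∷ r
  ∈-doubled⁺ z r (here refl) = ∈-++⁺ʳ z (here refl)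
  ∈-doubled⁺ z r (there c∈) with ∈-++⁻ z c∈
  ... | inj₁ c∈z = ∈-++⁺ˡ c∈z
  ... | inj₂ c∈r = ∈-++⁺ʳ z (there (there c∈r))

  ∈-doubled⁻ : ∀ {c a : A} z r → c ∈ z ++ a ∷ a ∷ r → c ∈ a ∷ z ++ r
  ∈-doubled⁻ z r c∈ with ∈-++⁻ z c∈
  ... | inj₁ c∈z                 = there (∈-++⁺ˡ c∈z)
  ... | inj₂ (here refl)         = here refl
  ... | inj₂ (there (here refl)) = here refl
  ... | inj₂ (there (there c∈r)) = there (∈-++⁺ʳ z c∈r)

  doubled-repeat : ∀ {a c : A} x z {m y r} → Unique (a ∷ z ++ r) →
    x ++ c ∷ m ++ c ∷ y ≡ z ++ a ∷ a ∷ r → c ≡ a × m ≡ []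
  doubled-repeat [] [] {[]}    _  refl = refl , refl
  doubled-repeat [] [] {_ ∷ m} uu refl = ⊥-elim (repeated⇒¬Unique [] (∈-++⁺ʳ m (here refl)) uu)
  doubled-repeat [] (_ ∷ z) {m} ((a≢c ∷ _) ∷ (c∉z++r ∷ _)) eq with ∷-injective eq
  ... | refl , eq′ with ∈-doubled⁻ z _ (subst (_ ∈_) eq′ (∈-++⁺ʳ m (here refl)))
  ...   | here c≡a = ⊥-elim (a≢c (sym c≡a))
  ...   | there c∈ = ⊥-elim (All.lookup c∉z++r c∈ refl)
  doubled-repeat (_ ∷ x) [] {m} ur eq = ⊥-elim
    (repeated⇒¬Unique x (∈-++⁺ʳ m (here refl)) (subst Unique (sym (proj₂ (∷-injective eq))) ur))
  doubled-repeat (_ ∷ x) (_ ∷ z) ((_ ∷ a∉) ∷ (_ ∷ u)) eq =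
    doubled-repeat x z (a∉ ∷ u) (proj₂ (∷-injective eq))

  length-doubled : ∀ (a : A) z r → length (z ++ a ∷ a ∷ r) ≡ 2 + length (z ++ r)
  length-doubled a z r = trans (length-++-sucʳ z a (a ∷ r)) (cong suc (length-++-sucʳ z a r))

  doubled⇒Rich : ∀ (a : A) z r → Unique (a ∷ z ++ r) → Rich (z ++ a ∷ a ∷ r)
  doubled⇒Rich a z r uu = L , uniqueL , (λ v → mk⇔ to from) , lengthL
    where
    u : List A
    u = z ++ a ∷ a ∷ r
    L : List (List A)
    L = (a ∷ a ∷ []) ∷ map [_] (a ∷ z ++ r)
    uniqueL : Unique L
    uniqueL = All-map⁺ (All.universal (λ _ ()) (a ∷ z ++ r)) ∷ Unique.map⁺ ∷-injectiveˡ uu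
    lengthL : length L ≡ length u
    lengthL = trans (cong suc (length-map [_] (a ∷ z ++ r))) (sym (length-doubled a z r))
    to : ∀ {v} → v ∈ L → NEPalFactor u v
    to (here refl) = (λ ()) , refl , z , r , refl
    to (there v∈) with ∈-map⁻ [_] v∈
    ... | _ , c∈ , refl = ∈⇒letter-NEPalFactor (∈-doubled⁺ z r c∈)
    from : ∀ {v} → NEPalFactor u v → v ∈ L
    from pf with NEPalFactor-cases pf
    ... | inj₁ (_ , refl , c∈u) = there (∈-map⁺ [_] (∈-doubled⁻ z r c∈u))
    ... | inj₂ (_ , _ , refl , x , _ , eq) with doubled-repeat x z uu eq
    ...   | refl , refl = here refl

  dropEmpty : List (List A) → List (List A)
  dropEmpty []             = []
  dropEmpty ([] ∷ Bs)      = dropEmpty Bs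
  dropEmpty ((c ∷ B) ∷ Bs) = (c ∷ B) ∷ dropEmpty Bs

  All-nonEmpty-dropEmpty : ∀ Bs → All (_≢ []) (dropEmpty Bs)
  All-nonEmpty-dropEmpty []             = []
  All-nonEmpty-dropEmpty ([] ∷ Bs)      = All-nonEmpty-dropEmpty Bs
  All-nonEmpty-dropEmpty ((_ ∷ _) ∷ Bs) = (λ ()) ∷ All-nonEmpty-dropEmpty Bs

  concat-dropEmpty : ∀ Bs → concat (dropEmpty Bs) ≡ concat Bs
  concat-dropEmpty []             = refl
  concat-dropEmpty ([] ∷ Bs)      = concat-dropEmpty Bs
  concat-dropEmpty ((c ∷ B) ∷ Bs) = cong (λ k → c ∷ B ++ k) (concat-dropEmpty Bs)

  concat-reverse-∷ : ∀ (B : List A) Bs → concat (reverse (B ∷ Bs)) ≡ concat (reverse Bs) ++ B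
  concat-reverse-∷ B Bs = begin
    concat (reverse (B ∷ Bs))      ≡⟨ cong concat (unfold-reverse B Bs) ⟩
    concat (reverse Bs ++ [ B ])   ≡⟨ concat-++ (reverse Bs) [ B ] ⟨
    concat (reverse Bs) ++ B ++ [] ≡⟨ cong (concat (reverse Bs) ++_) (++-identityʳ B) ⟩
    concat (reverse Bs) ++ B       ∎
    where open ≡-Reasoning

  concat-reverse-dropEmpty : ∀ Bs → concat (reverse (dropEmpty Bs)) ≡ concat (reverse Bs)
  concat-reverse-dropEmpty [] = refl
  concat-reverse-dropEmpty ([] ∷ Bs) = begin
    concat (reverse (dropEmpty Bs)) ≡⟨ concat-reverse-dropEmpty Bs ⟩
    concat (reverse Bs)             ≡⟨ ++-identityʳ _ ⟨
    concat (reverse Bs) ++ []       ≡⟨ concat-reverse-∷ [] Bs ⟨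
    concat (reverse ([] ∷ Bs))      ∎
    where open ≡-Reasoning
  concat-reverse-dropEmpty (B@(_ ∷ _) ∷ Bs) = begin
    concat (reverse (B ∷ dropEmpty Bs))  ≡⟨ concat-reverse-∷ B (dropEmpty Bs) ⟩
    concat (reverse (dropEmpty Bs)) ++ B ≡⟨ cong (_++ B) (concat-reverse-dropEmpty Bs) ⟩
    concat (reverse Bs) ++ B             ≡⟨ concat-reverse-∷ B Bs ⟨
    concat (reverse (B ∷ Bs))            ∎
    where open ≡-Reasoning

  concat-reverse∈BR : ∀ Bs → concat Bs ≢ [] → InBR (concat (reverse Bs)) (concat Bs)
  concat-reverse∈BR Bs ne =
    dropEmpty Bs ,
    (λ eq → ne (trans (sym (concat-dropEmpty Bs)) (cong concat eq))) ,
    All-nonEmpty-dropEmpty Bs ,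
    concat-dropEmpty Bs ,
    sym (concat-reverse-dropEmpty Bs)

  InBR-refl : ∀ {w : List A} → w ≢ [] → InBR w w
  InBR-refl {w} w≢[] = [ w ] , (λ ()) , w≢[] ∷ [] , ++-identityʳ w , sym (++-identityʳ w)

  doubled∈BR : ∀ x (a : A) y z → InBR (z ++ a ∷ a ∷ y ++ x) (x ++ a ∷ y ++ a ∷ z)
  doubled∈BR x a y z = subst₂ InBR
    (cong (λ k → z ++ a ∷ a ∷ y ++ k) (++-identityʳ x))
    (cong (λ k → x ++ a ∷ y ++ a ∷ k) (++-identityʳ z))
    (concat-reverse∈BR (x ∷ (a ∷ y) ∷ [ a ] ∷ z ∷ []) (λ eq → case ++-conicalʳ x _ eq of λ ()))

  OneRepetition : List A → Set
  OneRepetition w = ∃[ x ] ∃[ a ] ∃[ y ] ∃[ z ] w ≡ x ++ a ∷ y ++ a ∷ z × Unique (a ∷ x ++ y ++ z)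

  OneRepetition-head : ∀ {b : A} {w} → b ∈ w → Unique w → OneRepetition (b ∷ w)
  OneRepetition-head {b} b∈w uw with ∈-∃++ b∈w
  ... | y , z , refl = [] , b , y , z , refl ,
    PermutationProperties.Unique-resp-↭ (setoid A) (PermutationProperties.↭-shift (setoid A) y z) uw

  OneRepetition-∷ : ∀ {b : A} {w} → b ∉ w → OneRepetition w → OneRepetition (b ∷ w)
  OneRepetition-∷ {b} b∉w (x , a , y , z , refl , (a∉ ∷ u)) =
    b ∷ x , a , y , z , refl ,
    ((λ a≡b → b∉w (subst (_∈ _) a≡b (∈-++⁺ʳ x (here refl)))) ∷ a∉) ∷ Unique-∷ (b∉w ∘ dropped) u
    where
    dropped : x ++ y ++ z ⊆ x ++ a ∷ y ++ a ∷ z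
    dropped = ++⁺ʳ x (xs⊆x∷xs _ a ∘ ++⁺ʳ y (xs⊆x∷xs z a))

  Unique-swap-outer : ∀ (a : A) x y z → Unique (a ∷ x ++ y ++ z) → Unique (a ∷ z ++ y ++ x)
  Unique-swap-outer a x y z = PermutationProperties.Unique-resp-↭ (setoid A) (↭-prep a (begin
    x ++ y ++ z   ↭⟨ PermutationProperties.++-comm (setoid A) x (y ++ z) ⟩
    (y ++ z) ++ x ≡⟨ ++-assoc y z x ⟩
    y ++ z ++ x   ↭⟨ PermutationProperties.shifts (setoid A) y z ⟩
    z ++ y ++ x   ∎))
    where open Permutation (setoid A) using (↭-prep; module PermutationReasoning)
          open PermutationReasoning

module _ {A : Set} (_≟_ : DecidableEquality A) where
  open DecMembership _≟_ using (_∈?_)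

  alphSize-∷-∉ : ∀ {b} {w} → b ∉ w → alphSize _≟_ (b ∷ w) ≡ suc (alphSize _≟_ w)
  alphSize-∷-∉ {b} {w} b∉w = cong (suc ∘ length) (filter-all (¬? ∘ (b ≟_))
    (All.tabulate (λ c∈ b≡c → b∉w (subst (_∈ w) (sym b≡c) (∈-deduplicate⁻ _≟_ w c∈)))))

  alphSize-∷-∈ : ∀ {b} {w} → b ∈ w → alphSize _≟_ (b ∷ w) ≤ alphSize _≟_ w
  alphSize-∷-∈ {b} {w} b∈w = filter-notAll (¬? ∘ (b ≟_)) (deduplicate _≟_ w)
    (Any.map (λ b≡c b≢c → b≢c b≡c) (∈-deduplicate⁺ _≟_ b∈w))

  length≤alphSize⇒Unique : ∀ w → length w ≤ alphSize _≟_ w → Unique w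
  length≤alphSize⇒Unique []      _ = []
  length≤alphSize⇒Unique (b ∷ w) le with b ∈? w
  ... | yes b∈w =
    contradiction (≤-trans le (≤-trans (alphSize-∷-∈ b∈w) (length-deduplicate _≟_ w))) (n≮n _)
  ... | no  b∉w =
    Unique-∷ b∉w (length≤alphSize⇒Unique w (s≤s⁻¹ (subst (suc (length w) ≤_) (alphSize-∷-∉ b∉w) le)))

  length≤1+alphSize⇒Unique⊎OneRepetition : ∀ w → length w ≤ suc (alphSize _≟_ w) →
    Unique w ⊎ OneRepetition w
  length≤1+alphSize⇒Unique⊎OneRepetition []      _ = inj₁ []
  length≤1+alphSize⇒Unique⊎OneRepetition (b ∷ w) le with b ∈? w
  ... | yes b∈w =
    inj₂ (OneRepetition-head b∈w (length≤alphSize⇒Unique w (≤-trans (s≤s⁻¹ le) (alphSize-∷-∈ b∈w))))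
  ... | no  b∉w with length≤1+alphSize⇒Unique⊎OneRepetition w
                       (s≤s⁻¹ (subst (suc (length w) ≤_) (cong suc (alphSize-∷-∉ b∉w)) le))
  ...   | inj₁ uw = inj₁ (Unique-∷ b∉w uw)
  ...   | inj₂ rw = inj₂ (OneRepetition-∷ b∉w rw)

lemma3p3 : {A : Set} (_≟_ : DecidableEquality A) (n : ℕ) (w : List A) →
    1 ≤ n → length w ≡ n →
    (∀ u → InBR u w → ¬ Rich u) →
    alphSize _≟_ w + 1 < n
lemma3p3 _≟_ _ [] () refl _
lemma3p3 _≟_ _ w@(_ ∷ _) _ refl noRich with alphSize _≟_ w + 1 <? length w
... | yes p = p
... | no ¬p with length≤1+alphSize⇒Unique⊎OneRepetition _≟_ w
                   (≤-trans (≮⇒≥ ¬p) (≤-reflexive (+-comm _ 1)))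
...   | inj₁ uw = ⊥-elim (noRich w (InBR-refl (λ ())) (Unique⇒Rich uw))
...   | inj₂ (x , a , y , z , w≡xayaz , u) = ⊥-elim (noRich _
  (subst (InBR _) (sym w≡xayaz) (doubled∈BR x a y z))
  (doubled⇒Rich a z (y ++ x) (Unique-swap-outer a x y z u)))
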